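{- Let $(C,\mathcal{H},\mathcal{K})$ be a strong $axax$-free cycle intersection system. Let $C'$ be the cycle obtained from $C$ by deleting every vertex $v$ such that $v\notin H$ for all $H\in\mathcal{H}$ or $v\notin K$ for all $K\in\mathcal{K}$ (making the two cyclic neighbours of each deleted vertex adjacent), and let $\mathcal{H}'=\{H\cap V(C'):H\in\mathcal{H}\}$, $\mathcal{K}'=\{K\cap V(C'):K\in\mathcal{K}\}$. Then $(C',\mathcal{H}',\mathcal{K}')$ is also strong $axax$-free, and any intersection support for $(C',\mathcal{H}',\mathcal{K}')$ is also an intersection support for $(C,\mathcal{H},\mathcal{K})$.
   Context: Members of $\mathcal{H},\mathcal{K}$ are (not necessarily connected) induced subgraphs of $C$, identified with vertex sets; each $H\in\mathcal{H}$ is identified with its restriction $H\cap V(C')$. A family $\mathcal{F}$ is $axax$-free if there are no $F,F'\in\mathcal{F}$ and distinct vertices $a_1,x_1,a_2,x_2$ in this cyclic order with $a_1,a_2\in F\setminus F'$, $x_1,x_2\in F'$. The intersection property: for any $H\in\mathcal{H}$, $K\in\mathcal{K}$ and vertices $h_1,k_1,h_2,k_2$ in cyclic order with $h_1,h_2\in H$, $k_1,k_2\in K$, we have $H\cap K\neq\emptyset$. Strong $axax$-free: $\mathcal{H}$ and $\mathcal{K}$ both $axax$-free and the intersection property holds. An intersection support is a graph on $\mathcal{H}$ in which $\{H: H\cap K\ne\emptyset\}$ induces a connected subgraph for every $K\in\mathcal{K}$. -}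

module Defs where

open import Data.Nat using (ℕ)
open import Data.Fin using (Fin; _<_)
open import Data.Fin.Subset using (Subset; _∈_; _∉_; _∩_; ⋃; Nonempty)
open import Data.List using (tabulate)
open import Data.Product using (_×_; Σ)
open import Data.Sum using (_⊎_)
open import Data.Empty using (⊥)

-- The cycle C has vertex set Fin n, in cyclic order 0,1,...,n-1.
-- A family of (induced subgraphs of C identified with) vertex sets,
-- indexed by Fin m (repetitions allowed).
Family : ℕ → ℕ → Set
Family m n = Fin m → Subset n

CyclicOrder : ∀ {n} → Fin n → Fin n → Fin n → Fin n → Set
CyclicOrder a b c d =
  (a < b × b < c × c < d) ⊎ (b < c × c < d × d < a) ⊎
  (c < d × d < a × a < b) ⊎ (d < a × a < b × b < c)

AxaxFree : ∀ {m n} → Family m n → Set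
AxaxFree {m} {n} F =
  (i j : Fin m) (a₁ x₁ a₂ x₂ : Fin n) →
  CyclicOrder a₁ x₁ a₂ x₂ →
  a₁ ∈ F i → a₁ ∉ F j → a₂ ∈ F i → a₂ ∉ F j →
  x₁ ∈ F j → x₂ ∈ F j → ⊥

IntersectionProperty : ∀ {m l n} → Family m n → Family l n → Set
IntersectionProperty {m} {l} {n} H K =
  (i : Fin m) (j : Fin l) (h₁ k₁ h₂ k₂ : Fin n) →
  CyclicOrder h₁ k₁ h₂ k₂ →
  h₁ ∈ H i → h₂ ∈ H i → k₁ ∈ K j → k₂ ∈ K j →
  Nonempty (H i ∩ K j)

StrongAxaxFree : ∀ {m l n} → Family m n → Family l n → Set
StrongAxaxFree H K = AxaxFree H × AxaxFree K × IntersectionProperty H K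

keptVertices : ∀ {m l n} → Family m n → Family l n → Subset n
keptVertices H K = ⋃ (tabulate H) ∩ ⋃ (tabulate K)

restrict : ∀ {m n} → Subset n → Family m n → Family m n
restrict V F i = F i ∩ V

data WalkIn {m : ℕ} (E : Fin m → Fin m → Set) (P : Fin m → Set)
       : Fin m → Fin m → Set where
  here : ∀ {i} → WalkIn E P i i
  step : ∀ {i j k} → P j → (E i j ⊎ E j i) → WalkIn E P j k → WalkIn E P i k

InducesConnected : ∀ {m} → (Fin m → Fin m → Set) → (Fin m → Set) → Set
InducesConnected {m} E P = (i j : Fin m) → P i → P j → WalkIn E P i j

IntersectionSupport : ∀ {m l n} → Family m n → Family l n →
                      (Fin m → Fin m → Set) → Set
IntersectionSupport {m} {l} H K E =
  (j : Fin l) → InducesConnected E (λ i → Nonempty (H i ∩ K j))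

-- Passing from C to C' only shrinks the members of both families, and it keeps
-- the cyclic order of the surviving vertices, so any forbidden configuration in
-- C' is one in C: an axax-witness x ∉ F' j with x ∈ V(C') satisfies x ∉ F j.
-- Conversely a common vertex of H ∈ ℋ and K ∈ 𝒦 lies in some member of each
-- family, hence survives; so H' ∩ K' ≠ ∅ exactly when H ∩ K ≠ ∅, and the
-- vertex sets required to be connected in an intersection support are the same
-- for both systems.
module Submission where

open import Defs
open import Data.Nat using (ℕ; _≤_)
open import Data.Fin using (Fin; zero; suc)
open import Data.Fin.Subset using (Subset; _∈_; _∉_; _⊆_; _∩_; ⋃; Nonempty)
open import Data.Fin.Subset.Properties using (p∩q⊆p; p∩q⊆q; x∈p∩q⁺; x∈p∩q⁻; x∈p∪q⁺)
open import Data.List using (tabulate)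
open import Data.Product using (_×_; _,_)
open import Data.Sum using (inj₁; inj₂)

⊆⋃-tabulate : ∀ {m n} (F : Fin m → Subset n) (i : Fin m) → F i ⊆ ⋃ (tabulate F)
⊆⋃-tabulate F zero    x∈F = x∈p∪q⁺ (inj₁ x∈F)
⊆⋃-tabulate F (suc i) x∈F = x∈p∪q⁺ (inj₂ (⊆⋃-tabulate (λ k → F (suc k)) i x∈F))

∩⊆keptVertices : ∀ {m l n} (H : Family m n) (K : Family l n) i j →
                 H i ∩ K j ⊆ keptVertices H K
∩⊆keptVertices H K i j x∈H∩K with x∈p∩q⁻ (H i) (K j) x∈H∩K
... | x∈H , x∈K = x∈p∩q⁺ (⊆⋃-tabulate H i x∈H , ⊆⋃-tabulate K j x∈K)

∩-restrict-nonempty⁺ : ∀ {n} (p q V : Subset n) → p ∩ q ⊆ V →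
                       Nonempty (p ∩ q) → Nonempty ((p ∩ V) ∩ (q ∩ V))
∩-restrict-nonempty⁺ p q V p∩q⊆V (x , x∈p∩q) with x∈p∩q⁻ p q x∈p∩q
... | x∈p , x∈q = x , x∈p∩q⁺ (x∈p∩q⁺ (x∈p , x∈V) , x∈p∩q⁺ (x∈q , x∈V))
  where x∈V = p∩q⊆V x∈p∩q

∩-restrict-nonempty⁻ : ∀ {n} (p q V : Subset n) →
                       Nonempty ((p ∩ V) ∩ (q ∩ V)) → Nonempty (p ∩ q)
∩-restrict-nonempty⁻ p q V (x , x∈p∩V∩q∩V) with x∈p∩q⁻ (p ∩ V) (q ∩ V) x∈p∩V∩q∩V
... | x∈p∩V , x∈q∩V = x , x∈p∩q⁺ (p∩q⊆p p V x∈p∩V , p∩q⊆p q V x∈q∩V)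

∉-restrict⇒∉ : ∀ {n} (p V : Subset n) {x} → x ∈ V → x ∉ p ∩ V → x ∉ p
∉-restrict⇒∉ p V x∈V x∉p∩V x∈p = x∉p∩V (x∈p∩q⁺ (x∈p , x∈V))

WalkIn-map : ∀ {m} {E : Fin m → Fin m → Set} {P Q : Fin m → Set} →
             (∀ i → P i → Q i) → ∀ {a b} → WalkIn E P a b → WalkIn E Q a b
WalkIn-map P⊆Q here                 = here
WalkIn-map P⊆Q (step {j = k} Pk e w) = step (P⊆Q k Pk) e (WalkIn-map P⊆Q w)

InducesConnected-resp-⇔ : ∀ {m} {E : Fin m → Fin m → Set} {P Q : Fin m → Set} →
  (∀ i → P i → Q i) → (∀ i → Q i → P i) →
  InducesConnected E Q → InducesConnected E P
InducesConnected-resp-⇔ P⊆Q Q⊆P connected a b Pa Pb =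
  WalkIn-map Q⊆P (connected a b (P⊆Q a Pa) (P⊆Q b Pb))

module _ {n : ℕ} (V : Subset n) where

  AxaxFree-restrict : ∀ {m} (F : Family m n) → AxaxFree F → AxaxFree (restrict V F)
  AxaxFree-restrict F axax i j a₁ x₁ a₂ x₂ order a₁∈i a₁∉j a₂∈i a₂∉j x₁∈j x₂∈j =
    axax i j a₁ x₁ a₂ x₂ order
      (p∩q⊆p (F i) V a₁∈i) (∉-restrict⇒∉ (F j) V (p∩q⊆q (F i) V a₁∈i) a₁∉j)
      (p∩q⊆p (F i) V a₂∈i) (∉-restrict⇒∉ (F j) V (p∩q⊆q (F i) V a₂∈i) a₂∉j)
      (p∩q⊆p (F j) V x₁∈j) (p∩q⊆p (F j) V x₂∈j)

  module _ {m l : ℕ} (H : Family m n) (K : Family l n)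
           (∩⊆V : ∀ i j → H i ∩ K j ⊆ V) where

    IntersectionProperty-restrict :
      IntersectionProperty H K → IntersectionProperty (restrict V H) (restrict V K)
    IntersectionProperty-restrict ip i j h₁ k₁ h₂ k₂ order h₁∈H h₂∈H k₁∈K k₂∈K =
      ∩-restrict-nonempty⁺ (H i) (K j) V (∩⊆V i j)
        (ip i j h₁ k₁ h₂ k₂ order
          (p∩q⊆p (H i) V h₁∈H) (p∩q⊆p (H i) V h₂∈H)
          (p∩q⊆p (K j) V k₁∈K) (p∩q⊆p (K j) V k₂∈K))

    IntersectionSupport-unrestrict : (E : Fin m → Fin m → Set) →
      IntersectionSupport (restrict V H) (restrict V K) E → IntersectionSupport H K E
    IntersectionSupport-unrestrict E support j =
      InducesConnected-resp-⇔
        (λ i → ∩-restrict-nonempty⁺ (H i) (K j) V (∩⊆V i j))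
        (λ i → ∩-restrict-nonempty⁻ (H i) (K j) V)
        (support j)

proposition1 : (n m l : ℕ) → 3 ≤ n → (H : Family m n) (K : Family l n) →
    StrongAxaxFree H K →
    StrongAxaxFree (restrict (keptVertices H K) H) (restrict (keptVertices H K) K)
    × ((E : Fin m → Fin m → Set) →
       IntersectionSupport (restrict (keptVertices H K) H) (restrict (keptVertices H K) K) E →
       IntersectionSupport H K E)
proposition1 n m l _ H K (axaxH , axaxK , ip) =
  ( AxaxFree-restrict V H axaxH
  , AxaxFree-restrict V K axaxK
  , IntersectionProperty-restrict V H K (∩⊆keptVertices H K) ip )
  , IntersectionSupport-unrestrict V H K (∩⊆keptVertices H K)
  where V = keptVertices H K
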